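{- Let $\mathcal{A}$ be a MAD family on $\omega$ and $T\subseteq\omega^{<\omega}$ an $\mathcal{I}(\mathcal{A})^+$-branching tree. Then there is a subtree $S\subseteq T$ such that: (1) for every $s\in S$ there is $A_s\in\mathcal{A}$ with $suc_S(s)\in[A_s]^\omega$; (2) if $s\neq t$ are nodes of $S$, then $A_s\neq A_t$ and $suc_S(s)\cap suc_S(t)=\emptyset$.
   Context: A MAD family is a maximal family of infinite subsets of $\omega$ any two distinct members of which have finite intersection. $\mathcal{I}(\mathcal{A})$ is the ideal generated by $\mathcal{A}$ and the finite sets, $\mathcal{I}(\mathcal{A})^+=\wp(\omega)\setminus\mathcal{I}(\mathcal{A})$. For a tree $T\subseteq\omega^{<\omega}$ (closed under initial segments) and $s\in T$, $suc_T(s)=\{n\in\omega: s^\frown\langle n\rangle\in T\}$; $T$ is $\mathcal{I}(\mathcal{A})^+$-branching if $suc_T(s)\in\mathcal{I}(\mathcal{A})^+$ for every $s\in T$. -}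

module Defs where

open import Data.Nat using (ℕ; _≤_)
open import Data.Bool using (Bool; true; false)
open import Data.List using (List; []; _∷_; _++_)
open import Data.List.Relation.Unary.All using (All)
open import Data.List.Relation.Unary.Any using (Any)
open import Data.Product using (Σ; _×_; ∃)
open import Relation.Binary.PropositionalEquality using (_≡_; _≢_)
open import Relation.Nullary using (¬_)

Subset : Set
Subset = ℕ → Bool

_∈_ : ℕ → Subset → Set
n ∈ X = X n ≡ true

_≐_ : Subset → Subset → Set
X ≐ Y = ∀ n → X n ≡ Y n

_⊆_ : Subset → Subset → Set
X ⊆ Y = ∀ n → n ∈ X → n ∈ Y

Infinite : Subset → Set
Infinite X = ∀ N → ∃ λ n → N ≤ n × n ∈ X

FiniteIntersection : Subset → Subset → Set
FiniteIntersection X Y = ∃ λ N → ∀ n → N ≤ n → n ∈ X → ¬ (n ∈ Y)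

Disjoint : Subset → Subset → Set
Disjoint X Y = ∀ n → n ∈ X → ¬ (n ∈ Y)

Family : Set₁
Family = Subset → Set

IsMAD : Family → Set
IsMAD 𝒜 =
  (∀ A → 𝒜 A → Infinite A)
  × (∀ A B → 𝒜 A → 𝒜 B → ¬ (A ≐ B) → FiniteIntersection A B)
  × (∀ X → Infinite X → ∃ λ A → 𝒜 A × ¬ FiniteIntersection X A)

InIdeal : Family → Subset → Set
InIdeal 𝒜 X = Σ (List Subset) λ L → All 𝒜 L ×
  (∃ λ N → ∀ n → N ≤ n → n ∈ X → Any (λ A → n ∈ A) L)

InIdealPlus : Family → Subset → Set
InIdealPlus 𝒜 X = ¬ InIdeal 𝒜 X

Tree : Set
Tree = List ℕ → Bool

_∈T_ : List ℕ → Tree → Set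
s ∈T T = T s ≡ true

IsTree : Tree → Set
IsTree T = ([] ∈T T) × (∀ s u → (s ++ u) ∈T T → s ∈T T)

suc[_] : Tree → List ℕ → Subset
suc[ T ] s n = T (s ++ n ∷ [])

IsBranching : Family → Tree → Set
IsBranching 𝒜 T = ∀ s → s ∈T T → InIdealPlus 𝒜 (suc[ T ] s)

_⊆T_ : Tree → Tree → Set
S ⊆T T = ∀ s → s ∈T S → s ∈T T

-- Enumerate the finite sequences as s₀, s₁, … and run through them once. At stage k
-- the successor set Y of the current node is I(𝒜)⁺, so it stays I(𝒜)⁺ after removing
-- the finitely many members B₀, …, B_{k-1} of 𝒜 chosen so far; in particular it is
-- infinite, and maximality of 𝒜 yields B_k ∈ 𝒜 meeting Y ∖ (B₀ ∪ … ∪ B_{k-1}) in an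
-- infinite set D_k. As D_k avoids every earlier B_j, the B_k are distinct and the D_k
-- pairwise disjoint, so the tree whose successor set at sₖ is D_k is the required subtree.
module Submission where

open import Defs
open import Level using (0ℓ)
open import Axiom.ExcludedMiddle using (ExcludedMiddle)
open import Axiom.DoubleNegationElimination using (em⇒dne)
open import Data.Bool using (Bool; true; false; _∧_; _∨_; not)
open import Data.Bool.Properties using (∧-assoc; ∧-identityʳ)
open import Data.List using (List; []; _∷_; _++_)
open import Data.List.Properties using (++-assoc; ++-identityʳ)
open import Data.List.Relation.Unary.All using (All; []; _∷_)
import Data.List.Relation.Unary.All.Properties as All
open import Data.List.Relation.Unary.Any using (Any; here; there)
import Data.List.Relation.Unary.Any.Properties as Any
open import Data.Nat using (ℕ; zero; suc; _≤_; _<_; s≤s; _*_)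
open import Data.Nat.Properties using (<-cmp; m≤n⇒m<n∨m≡n; suc-injective; *-cancelˡ-≡; even≢odd)
open import Data.Product using (Σ; ∃; _×_; _,_; proj₁; proj₂)
open import Data.Sum using (inj₁; inj₂)
open import Relation.Binary using (tri<; tri≈; tri>)
open import Relation.Binary.PropositionalEquality using (_≡_; _≢_; refl; sym; trans; cong; subst)
open import Relation.Nullary using (¬_; Dec; yes; no; contradiction)

-- pair n m = 2ⁿ(2m + 1) − 1
pair : ℕ → ℕ → ℕ
pair zero    m = 2 * m
pair (suc n) m = suc (2 * pair n m)

pair-injective : ∀ n m n′ m′ → pair n m ≡ pair n′ m′ → n ≡ n′ × m ≡ m′
pair-injective zero    m zero     m′ e = refl , *-cancelˡ-≡ m m′ 2 e
pair-injective zero    m (suc n′) m′ e = contradiction e (even≢odd m (pair n′ m′))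
pair-injective (suc n) m zero     m′ e = contradiction (sym e) (even≢odd m′ (pair n m))
pair-injective (suc n) m (suc n′) m′ e
  with pair-injective n m n′ m′ (*-cancelˡ-≡ _ _ 2 (suc-injective e))
... | refl , refl = refl , refl

code : List ℕ → ℕ
code []      = zero
code (n ∷ s) = suc (pair n (code s))

code-injective : ∀ s t → code s ≡ code t → s ≡ t
code-injective []      []      _ = refl
code-injective (n ∷ s) (m ∷ t) e
  with pair-injective n (code s) m (code t) (suc-injective e)
... | refl , e′ = cong (n ∷_) (code-injective s t e′)

infixl 30 _∩_ _∖_

_∩_ : Subset → Subset → Subset
(X ∩ Y) n = X n ∧ Y n

_∖_ : Subset → Subset → Subset
(X ∖ Y) n = X n ∧ not (Y n)

⋃ : List Subset → Subset
⋃ []      n = false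
⋃ (X ∷ L) n = X n ∨ ⋃ L n

∧≡true⁻ : ∀ {a b} → a ∧ b ≡ true → a ≡ true × b ≡ true
∧≡true⁻ {true} {true} refl = refl , refl

∩⊆ˡ : ∀ X Y → X ∩ Y ⊆ X
∩⊆ˡ X Y n p = proj₁ (∧≡true⁻ p)

∩⊆ʳ : ∀ X Y → X ∩ Y ⊆ Y
∩⊆ʳ X Y n p = proj₂ (∧≡true⁻ {X n} p)

∈-∩⁺ : ∀ X Y n → n ∈ X → n ∈ Y → n ∈ X ∩ Y
∈-∩⁺ X Y n p q rewrite p | q = refl

∖⊆ : ∀ X Y → X ∖ Y ⊆ X
∖⊆ X Y n p = proj₁ (∧≡true⁻ p)

∖-Disjoint : ∀ X Y → Disjoint (X ∖ Y) Y
∖-Disjoint X Y n p q = contradiction (trans (sym (cong not q)) (proj₂ (∧≡true⁻ {X n} p))) λ ()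

∈-∖⁺ : ∀ X Y n → n ∈ X → Y n ≡ false → n ∈ X ∖ Y
∈-∖⁺ X Y n p q rewrite p | q = refl

∈-⋃⁻ : ∀ L n → n ∈ ⋃ L → Any (n ∈_) L
∈-⋃⁻ (X ∷ L) n p with X n in eq
... | true  = here eq
... | false = there (∈-⋃⁻ L n p)

∈-⋃⁺ : ∀ {L} n → Any (n ∈_) L → n ∈ ⋃ L
∈-⋃⁺ n (here p) rewrite p = refl
∈-⋃⁺ {X ∷ _} n (there q) rewrite ∈-⋃⁺ n q with X n
... | true  = refl
... | false = refl

≐⇒⊆ : ∀ {X Y} → X ≐ Y → X ⊆ Y
≐⇒⊆ X≐Y n p = trans (sym (X≐Y n)) p

⊆-trans : ∀ {X Y Z} → X ⊆ Y → Y ⊆ Z → X ⊆ Z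
⊆-trans X⊆Y Y⊆Z n p = Y⊆Z n (X⊆Y n p)

Infinite-mono : ∀ {X Y} → X ⊆ Y → Infinite X → Infinite Y
Infinite-mono X⊆Y inf N with inf N
... | n , N≤n , p = n , N≤n , X⊆Y n p

Disjoint-anti : ∀ {X X′ Y Y′} → X′ ⊆ X → Y′ ⊆ Y → Disjoint X Y → Disjoint X′ Y′
Disjoint-anti X′⊆X Y′⊆Y X⊥Y n p q = X⊥Y n (X′⊆X n p) (Y′⊆Y n q)

Disjoint-sym : ∀ {X Y} → Disjoint X Y → Disjoint Y X
Disjoint-sym X⊥Y n p q = X⊥Y n q p

∖⋃-positive : ∀ {𝒜 X} L → All 𝒜 L → InIdealPlus 𝒜 X → InIdealPlus 𝒜 (X ∖ ⋃ L)
∖⋃-positive {X = X} L L⊆𝒜 X⁺ (L′ , L′⊆𝒜 , N , covered) =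
  X⁺ (L′ ++ L , All.++⁺ L′⊆𝒜 L⊆𝒜 , N , coveredX)
  where
  coveredX : ∀ n → N ≤ n → n ∈ X → Any (n ∈_) (L′ ++ L)
  coveredX n N≤n p with ⋃ L n in eq
  ... | true  = Any.++⁺ʳ L′ (∈-⋃⁻ L n eq)
  ... | false = Any.++⁺ˡ (covered n N≤n (∈-∖⁺ X (⋃ L) n p eq))

module _ (em : ExcludedMiddle 0ℓ) where

  dne : {P : Set} → ¬ ¬ P → P
  dne = em⇒dne em

  positive⇒infinite : ∀ {𝒜 X} → InIdealPlus 𝒜 X → Infinite X
  positive⇒infinite X⁺ N = dne λ bounded →
    X⁺ ([] , [] , N , λ n N≤n p → contradiction (n , N≤n , p) bounded)

  ¬finite⇒infinite-∩ : ∀ X Y → ¬ FiniteIntersection X Y → Infinite (X ∩ Y)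
  ¬finite⇒infinite-∩ X Y infinite N = dne λ bounded →
    infinite (N , λ n N≤n p q → bounded (n , N≤n , ∈-∩⁺ X Y n p q))

symmetric-by-< : {R : ℕ → ℕ → Set} → (∀ {j k} → R j k → R k j) →
                 (∀ {j k} → j < k → R j k) → ∀ {j k} → j ≢ k → R j k
symmetric-by-< sym-R R< {j} {k} j≢k with <-cmp j k
... | tri< j<k _ _ = R< j<k
... | tri≈ _ j≡k _ = contradiction j≡k j≢k
... | tri> _ _ k<j = sym-R (R< k<j)

record AlmostDisjointRefinement (𝒜 : Family) (Y : ℕ → Subset) : Set where
  field
    B D        : ℕ → Subset
    B∈𝒜        : ∀ k → 𝒜 (B k)
    D⊆B        : ∀ k → D k ⊆ B k
    D⊆Y        : ∀ k → D k ⊆ Y k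
    D-infinite : ∀ k → Infinite (D k)
    separated  : ∀ {j k} → j ≢ k → ¬ (B j ≐ B k) × Disjoint (D j) (D k)

module Refine (em : ExcludedMiddle 0ℓ) {𝒜 : Family} (mad : IsMAD 𝒜)
              (Y : ℕ → Subset) (Y⁺ : ∀ k → InIdealPlus 𝒜 (Y k)) where

  Chosen : Set
  Chosen = Σ (List Subset) (All 𝒜)

  next : (k : ℕ) (C : Chosen) → ∃ λ A → 𝒜 A × ¬ FiniteIntersection (Y k ∖ ⋃ (proj₁ C)) A
  next k (L , L⊆𝒜) =
    proj₂ (proj₂ mad) (Y k ∖ ⋃ L) (positive⇒infinite em (∖⋃-positive L L⊆𝒜 (Y⁺ k)))

  chosen : ℕ → Chosen
  chosen zero    = [] , []
  chosen (suc k) = proj₁ step ∷ proj₁ (chosen k) , proj₁ (proj₂ step) ∷ proj₂ (chosen k)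
    where step = next k (chosen k)

  B : ℕ → Subset
  B k = proj₁ (next k (chosen k))

  fresh : ℕ → Subset
  fresh k = Y k ∖ ⋃ (proj₁ (chosen k))

  D : ℕ → Subset
  D k = fresh k ∩ B k

  earlier-chosen : ∀ {j k} → j < k → ∀ n → n ∈ B j → Any (n ∈_) (proj₁ (chosen k))
  earlier-chosen {k = suc k} (s≤s j≤k) n p with m≤n⇒m<n∨m≡n j≤k
  ... | inj₁ j<k  = there (earlier-chosen j<k n p)
  ... | inj₂ refl = here p

  fresh-avoids-earlier : ∀ {j k} → j < k → Disjoint (fresh k) (B j)
  fresh-avoids-earlier {k = k} j<k n p q =
    ∖-Disjoint (Y k) (⋃ (proj₁ (chosen k))) n p (∈-⋃⁺ n (earlier-chosen j<k n q))

  separated-< : ∀ {j k} → j < k → ¬ (B j ≐ B k) × Disjoint (D j) (D k)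
  separated-< {j} {k} j<k =
      (λ Bj≐Bk → proj₂ (proj₂ (next k (chosen k)))
        (0 , λ n _ p q → fresh-avoids-earlier j<k n p (≐⇒⊆ (λ m → sym (Bj≐Bk m)) n q)))
    , λ n p q → fresh-avoids-earlier j<k n (∩⊆ˡ (fresh k) (B k) n q) (∩⊆ʳ (fresh j) (B j) n p)

  refinement : AlmostDisjointRefinement 𝒜 Y
  refinement = record
    { B          = B
    ; D          = D
    ; B∈𝒜        = λ k → proj₁ (proj₂ (next k (chosen k)))
    ; D⊆B        = λ k → ∩⊆ʳ (fresh k) (B k)
    ; D⊆Y        = λ k → ⊆-trans (∩⊆ˡ (fresh k) (B k)) (∖⊆ (Y k) _)
    ; D-infinite = λ k → ¬finite⇒infinite-∩ em (fresh k) (B k) (proj₂ (proj₂ (next k (chosen k))))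
    ; separated  = symmetric-by-< (λ (B≢ , D⊥) → (λ e → B≢ λ m → sym (e m)) , Disjoint-sym D⊥)
                                  separated-<
    }

follows : (List ℕ → Subset) → List ℕ → List ℕ → Bool
follows Z acc []      = true
follows Z acc (n ∷ s) = Z acc n ∧ follows Z (acc ++ n ∷ []) s

treeOf : (List ℕ → Subset) → Tree
treeOf Z = follows Z []

follows-++ : ∀ Z acc s u → follows Z acc (s ++ u) ≡ follows Z acc s ∧ follows Z (acc ++ s) u
follows-++ Z acc []      u rewrite ++-identityʳ acc = refl
follows-++ Z acc (n ∷ s) u rewrite follows-++ Z (acc ++ n ∷ []) s u | ++-assoc acc (n ∷ []) s =
  sym (∧-assoc (Z acc n) (follows Z (acc ++ n ∷ []) s) (follows Z (acc ++ n ∷ s) u))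

treeOf-isTree : ∀ Z → IsTree (treeOf Z)
treeOf-isTree Z = refl , λ s u p → proj₁ (∧≡true⁻ (trans (sym (follows-++ Z [] s u)) p))

suc-treeOf : ∀ Z s → s ∈T treeOf Z → suc[ treeOf Z ] s ≐ Z s
suc-treeOf Z s p n rewrite follows-++ Z [] s (n ∷ []) | p = ∧-identityʳ (Z s n)

treeOf-⊆T : ∀ Z {T} → [] ∈T T → (∀ s → s ∈T T → Z s ⊆ suc[ T ] s) → treeOf Z ⊆T T
treeOf-⊆T Z {T} root Z⊆suc s = extend [] s root
  where
  extend : ∀ acc s → acc ∈T T → follows Z acc s ≡ true → (acc ++ s) ∈T T
  extend acc []      p _ rewrite ++-identityʳ acc = p
  extend acc (n ∷ s) p q rewrite sym (++-assoc acc (n ∷ []) s) =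
    extend (acc ++ n ∷ []) s (Z⊆suc acc p n (proj₁ step)) (proj₂ step)
    where step = ∧≡true⁻ {Z acc n} q

lemma11 : ExcludedMiddle 0ℓ →
    (𝒜 : Family) → IsMAD 𝒜 → (T : Tree) → IsTree T → IsBranching 𝒜 T →
    Σ Tree λ S → IsTree S × S ⊆T T ×
      Σ (List ℕ → Subset) λ A →
        (∀ s → s ∈T S → 𝒜 (A s) × suc[ S ] s ⊆ A s × Infinite (suc[ S ] s))
        × (∀ s t → s ∈T S → t ∈T S → s ≢ t →
             ¬ (A s ≐ A t) × Disjoint (suc[ S ] s) (suc[ S ] t))
lemma11 em 𝒜 mad T (root , _) branching =
    treeOf Z , treeOf-isTree Z , treeOf-⊆T Z root Z⊆suc , A
  , (λ s p → B∈𝒜 (code s) , ⊆-trans (suc-S s p) (D⊆B (code s))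
           , Infinite-mono (≐⇒⊆ λ n → sym (suc-treeOf Z s p n)) (D-infinite (code s)))
  , λ s t p q s≢t → let (B≢ , D⊥) = separated (λ e → s≢t (code-injective s t e))
                    in B≢ , Disjoint-anti (suc-S s p) (suc-S t q) D⊥
  where
  Coded : ℕ → Set
  Coded k = ∃ λ s → code s ≡ k × s ∈T T

  node : (k : ℕ) → Dec (Coded k) → List ℕ
  node k (yes (s , _)) = s
  node k (no _)        = []

  node∈T : ∀ k d → node k d ∈T T
  node∈T k (yes (_ , _ , p)) = p
  node∈T k (no _)            = root

  node-code : ∀ s → s ∈T T → (d : Dec (Coded (code s))) → node (code s) d ≡ s
  node-code s p (yes (t , e , _)) = code-injective t s e
  node-code s p (no ¬coded)       = contradiction (s , refl , p) ¬coded

  open AlmostDisjointRefinement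
         (Refine.refinement em mad (λ k → suc[ T ] (node k em)) (λ k → branching _ (node∈T k em)))

  Z A : List ℕ → Subset
  Z s = D (code s)
  A s = B (code s)

  Z⊆suc : ∀ s → s ∈T T → Z s ⊆ suc[ T ] s
  Z⊆suc s p n q = subst (λ u → n ∈ suc[ T ] u) (node-code s p em) (D⊆Y (code s) n q)

  suc-S : ∀ s → s ∈T treeOf Z → suc[ treeOf Z ] s ⊆ Z s
  suc-S s p = ≐⇒⊆ (suc-treeOf Z s p)
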